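{- Let $\lambda$ be a partition (straight shape). In the snake sequence $\mathrm{SS}(\lambda)$, every letter $L$ occurs strictly to the left of every letter $R$.
   Context: Young diagram $\lambda=\{(i,j):1\le j\le\lambda_i\}$, rows indexed downward. An edge $e$ is an edge of the lower envelope of $\lambda$ if it is the lower or right-hand edge of some square of $\lambda$ and no square of $\lambda$ has $e$ as its upper or left-hand edge. Snakes: if $e$ is horizontal and $(i,j)\in\lambda$ has $e$ as lower edge, $S_e=\lambda\cap\{(i,j),(i,j-1),(i-1,j-1),(i-1,j-2),(i-2,j-2),\ldots\}$; if $e$ is vertical and $(i,j)\in\lambda$ has $e$ as right-hand edge, $S_e=\lambda\cap\{(i,j),(i-1,j),(i-1,j-1),(i-2,j-1),\ldots\}$. The length of a snake is its number of squares minus one. Ordering the lower-envelope edges from lower left to upper right and writing $L$ for a snake of even length with $e$ horizontal, $R$ for a snake of even length with $e$ vertical, and $O$ for a snake of odd length, one obtains the word $\mathrm{SS}(\lambda)$. -}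

module Defs where

open import Data.Nat using (ℕ; zero; suc; _+_; _*_; _∸_; _≤_; _<_; _≥_; _≤?_)
open import Data.Bool using (Bool; true; false)
open import Data.Nat.Properties using (_≟_)
open import Data.List using (List; []; _∷_; length; filter)
open import Data.List.Relation.Unary.Linked using (Linked)
open import Data.List.Relation.Unary.All using (All)
open import Data.Product using (_×_; _,_)
open import Relation.Binary.PropositionalEquality using (_≡_)
open import Relation.Nullary using (¬_; Dec; yes; no)
open import Relation.Nullary.Decidable using (_×-dec_)

IsPartition : List ℕ → Set
IsPartition λs = Linked _≥_ λs × All (λ p → 1 ≤ p) λs

-- λ_i (rows indexed from 1); λ_i = 0 for i = 0 or i > ℓ.
part : List ℕ → ℕ → ℕ
part []       _             = 0
part (p ∷ ps) zero          = 0
part (p ∷ ps) (suc zero)    = p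
part (p ∷ ps) (suc (suc i)) = part ps (suc i)

-- Cells (i , j) : row i (downward), column j.
Cell : Set
Cell = ℕ × ℕ

-- (i , j) ∈ λ  iff  1 ≤ i and 1 ≤ j ≤ λ_i  (1 ≤ i is automatic since λ_0 = 0).
_∈Y_ : Cell → List ℕ → Set
(i , j) ∈Y λs = 1 ≤ j × j ≤ part λs i

_∈Y?_ : (c : Cell) → (λs : List ℕ) → Dec (c ∈Y λs)
(i , j) ∈Y? λs = (1 ≤? j) ×-dec (j ≤? part λs i)

-- Unit edges of the lattice, named by an adjacent square:
--   lowerE i j : the lower edge of square (i , j)
--   rightE i j : the right-hand edge of square (i , j)
-- (the lower edge of (i , j) is the upper edge of (i+1 , j);
--  the right edge of (i , j) is the left edge of (i , j+1).)
data Edge : Set where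
  lowerE : ℕ → ℕ → Edge
  rightE : ℕ → ℕ → Edge

LowerEnvelope : List ℕ → Edge → Set
LowerEnvelope λs (lowerE i j) = ((i , j) ∈Y λs) × ¬ ((suc i , j) ∈Y λs)
LowerEnvelope λs (rightE i j) = ((i , j) ∈Y λs) × ¬ ((i , suc j) ∈Y λs)

-- The infinite zig-zag sequences of cells, truncated once a coordinate
-- reaches 0 (from then on no cell can lie in λ).
--   goLeft i j = (i,j),(i,j-1),(i-1,j-1),(i-1,j-2),…
--   goUp   i j = (i,j),(i-1,j),(i-1,j-1),(i-2,j-1),…
mutual
  goLeft : ℕ → ℕ → List Cell
  goLeft zero    _       = []
  goLeft (suc i) zero    = []
  goLeft (suc i) (suc j) = (suc i , suc j) ∷ goUp (suc i) j

  goUp : ℕ → ℕ → List Cell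
  goUp zero    _       = []
  goUp (suc i) zero    = []
  goUp (suc i) (suc j) = (suc i , suc j) ∷ goLeft i (suc j)

snake : List ℕ → Edge → List Cell
snake λs (lowerE i j) = filter (_∈Y? λs) (goLeft i j)
snake λs (rightE i j) = filter (_∈Y? λs) (goUp i j)

snakeLength : List ℕ → Edge → ℕ
snakeLength λs e = length (snake λs e) ∸ 1

data Letter : Set where
  L R O : Letter

isEven : ℕ → Bool
isEven zero          = true
isEven (suc zero)    = false
isEven (suc (suc n)) = isEven n

letter : List ℕ → Edge → Letter
letter λs e with isEven (snakeLength λs e) | e
... | false | _          = O
... | true  | lowerE _ _ = L
... | true  | rightE _ _ = R

-- Position of an edge along the lower envelope, via doubled coordinates of
-- its midpoint (shifted by +1 to stay in ℕ):
--   xc = horizontal coordinate (increasing to the right),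
--   yc = depth (increasing downward).
xc : Edge → ℕ
xc (lowerE i j) = 2 * j
xc (rightE i j) = 2 * j + 1

yc : Edge → ℕ
yc (lowerE i j) = 2 * i + 1
yc (rightE i j) = 2 * i

-- e occurs strictly before e' when the lower envelope is traversed from lower
-- left to upper right (the envelope is a monotone lattice path, so this is
-- the componentwise order on midpoints).
_Precedes_ : Edge → Edge → Set
e Precedes e' = xc e ≤ xc e' × yc e' ≤ yc e × ¬ (e ≡ e')

-- The snake of a lower-envelope edge never leaves λ, because λ is closed
-- under moving up and left; so it runs until it reaches row 0 or column 0
-- and its length is determined by the edge alone.  Counting squares, an
-- L-snake from the lower edge of (i , j) has even length only if j ≤ i,
-- and an R-snake from the right edge of (i , j) only if i ≤ j.  The lower
-- envelope is a monotone lattice path, so an edge weakly below the diagonal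
-- can only be followed by one weakly above it, never the other way round.
module Submission where

open import Defs
open import Data.Nat using (ℕ; zero; suc; _+_; _*_; _∸_; _≤_; _<_; _≥_; z≤n; s≤s; _≤?_)
open import Data.Nat.Properties
  using (≤-refl; ≤-trans; <-irrefl; +-suc; *-monoʳ-≤; m≤m+n; n≤1+n; ≰⇒>; ≮⇒≥; module ≤-Reasoning)
open import Data.Bool using (true; false)
open import Data.List using (List; []; _∷_; length)
open import Data.List.Properties using (filter-all)
open import Data.List.Relation.Unary.Linked using (Linked; _∷_; tail)
open import Data.List.Relation.Unary.All using (All; []; _∷_)
open import Data.Product using (_,_; proj₁; proj₂)
open import Function using (_∘_)
open import Relation.Nullary using (¬_; yes; no; contradiction)
open import Relation.Binary.PropositionalEquality using (_≡_; _≢_; refl; sym; trans; cong; module ≡-Reasoning)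

private
  variable
    λs : List ℕ
    i j i' j' : ℕ

part-antitone : Linked _≥_ λs → ∀ {a b} → a ≤ b → part λs (suc b) ≤ part λs (suc a)
part-antitone _ {zero} {zero} _ = ≤-refl
part-antitone {[]} _ _ = z≤n
part-antitone {_ ∷ []} _ {zero} {suc _} _ = z≤n
part-antitone {_ ∷ _ ∷ _} (p≥q ∷ l) {zero} {suc b} _ = ≤-trans (part-antitone l {b = b} z≤n) p≥q
part-antitone {_ ∷ _} l {suc _} {suc _} (s≤s a≤b) = part-antitone (tail l) a≤b

row0∉λ : ∀ λs → ¬ ((0 , j) ∈Y λs)
row0∉λ [] (1≤j , j≤0) = contradiction (≤-trans 1≤j j≤0) λ ()
row0∉λ (_ ∷ _) (1≤j , j≤0) = contradiction (≤-trans 1≤j j≤0) λ ()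

mutual
  goLeft-⊆λ : Linked _≥_ λs → j ≤ part λs i → All (_∈Y λs) (goLeft i j)
  goLeft-⊆λ {i = zero} _ _ = []
  goLeft-⊆λ {j = zero} {i = suc _} _ _ = []
  goLeft-⊆λ {j = suc j} {i = suc i} l j≤λᵢ =
    (s≤s z≤n , j≤λᵢ) ∷ goUp-⊆λ l (≤-trans (n≤1+n j) j≤λᵢ)

  goUp-⊆λ : Linked _≥_ λs → j ≤ part λs i → All (_∈Y λs) (goUp i j)
  goUp-⊆λ {i = zero} _ _ = []
  goUp-⊆λ {j = zero} {i = suc _} _ _ = []
  goUp-⊆λ {j = suc _} {i = suc zero} _ j≤λᵢ = (s≤s z≤n , j≤λᵢ) ∷ []
  goUp-⊆λ {j = suc _} {i = suc (suc i)} l j≤λᵢ =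
    (s≤s z≤n , j≤λᵢ) ∷ goLeft-⊆λ l (≤-trans j≤λᵢ (part-antitone l (n≤1+n i)))

length-goLeft : i < j → length (goLeft i j) ≡ i + i
length-goLeft {zero} _ = refl
length-goLeft {suc i} {suc (suc j)} (s≤s i<1+j) =
  cong suc (trans (cong suc (length-goLeft i<1+j)) (sym (+-suc i i)))

length-goUp : j < i → length (goUp i j) ≡ j + j
length-goUp {zero} {suc _} _ = refl
length-goUp {suc j} {suc (suc i)} (s≤s j<1+i) =
  cong suc (trans (cong suc (length-goUp j<1+i)) (sym (+-suc j j)))

snakeLength-lowerE : Linked _≥_ λs → j ≤ part λs i → i < j → snakeLength λs (lowerE i j) ≡ i + i ∸ 1
snakeLength-lowerE {λs} {j} {i} l j≤λᵢ i<j = begin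
  length (snake λs (lowerE i j)) ∸ 1 ≡⟨ cong (λ xs → length xs ∸ 1) (filter-all (_∈Y? λs) (goLeft-⊆λ l j≤λᵢ)) ⟩
  length (goLeft i j) ∸ 1            ≡⟨ cong (_∸ 1) (length-goLeft i<j) ⟩
  i + i ∸ 1                          ∎
  where open ≡-Reasoning

snakeLength-rightE : Linked _≥_ λs → j ≤ part λs i → j < i → snakeLength λs (rightE i j) ≡ j + j ∸ 1
snakeLength-rightE {λs} {j} {i} l j≤λᵢ j<i = begin
  length (snake λs (rightE i j)) ∸ 1 ≡⟨ cong (λ xs → length xs ∸ 1) (filter-all (_∈Y? λs) (goUp-⊆λ l j≤λᵢ)) ⟩
  length (goUp i j) ∸ 1              ≡⟨ cong (_∸ 1) (length-goUp j<i) ⟩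
  j + j ∸ 1                          ∎
  where open ≡-Reasoning

isEven-odd : ∀ k → isEven (k + suc k) ≡ false
isEven-odd zero = refl
isEven-odd (suc k) = trans (cong (isEven ∘ suc) (+-suc k (suc k))) (isEven-odd k)

isEven-snakeLength-lowerE⇒col≤row : Linked _≥_ λs → (i , j) ∈Y λs →
  isEven (snakeLength λs (lowerE i j)) ≡ true → j ≤ i
isEven-snakeLength-lowerE⇒col≤row {λs} {i = zero} _ top∈λ _ = contradiction top∈λ (row0∉λ λs)
isEven-snakeLength-lowerE⇒col≤row {λs} {suc k} {j} l (_ , j≤λᵢ) even with j ≤? suc k
... | yes j≤i = j≤i
... | no j≰i  = contradiction (trans (sym even) odd) λ ()
  where
  odd : isEven (snakeLength λs (lowerE (suc k) j)) ≡ false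
  odd = trans (cong isEven (snakeLength-lowerE l j≤λᵢ (≰⇒> j≰i))) (isEven-odd k)

isEven-snakeLength-rightE⇒row≤col : Linked _≥_ λs → (i , j) ∈Y λs →
  isEven (snakeLength λs (rightE i j)) ≡ true → i ≤ j
isEven-snakeLength-rightE⇒row≤col {j = zero} _ (() , _) _
isEven-snakeLength-rightE⇒row≤col {λs} {i} {suc k} l (_ , j≤λᵢ) even with i ≤? suc k
... | yes i≤j = i≤j
... | no i≰j  = contradiction (trans (sym even) odd) λ ()
  where
  odd : isEven (snakeLength λs (rightE i (suc k))) ≡ false
  odd = trans (cong isEven (snakeLength-rightE l j≤λᵢ (≰⇒> i≰j))) (isEven-odd k)

letter-lowerE≡L⇒isEven : ∀ λs i j → letter λs (lowerE i j) ≡ L → isEven (snakeLength λs (lowerE i j)) ≡ true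
letter-lowerE≡L⇒isEven λs i j with isEven (snakeLength λs (lowerE i j))
... | true  = λ _ → refl
... | false = λ ()

letter-rightE≡R⇒isEven : ∀ λs i j → letter λs (rightE i j) ≡ R → isEven (snakeLength λs (rightE i j)) ≡ true
letter-rightE≡R⇒isEven λs i j with isEven (snakeLength λs (rightE i j))
... | true  = λ _ → refl
... | false = λ ()

letter-rightE≢L : ∀ λs i j → letter λs (rightE i j) ≢ L
letter-rightE≢L λs i j with isEven (snakeLength λs (rightE i j))
... | true  = λ ()
... | false = λ ()

letter-lowerE≢R : ∀ λs i j → letter λs (lowerE i j) ≢ R
letter-lowerE≢R λs i j with isEven (snakeLength λs (lowerE i j))
... | true  = λ ()
... | false = λ ()

lowerEnvelope-lowerE⇒part< : ∀ λs i → LowerEnvelope λs (lowerE i j) → part λs (suc i) < j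
lowerEnvelope-lowerE⇒part< _ _ ((1≤j , _) , below∉λ) = ≰⇒> (λ j≤λ₁₊ᵢ → below∉λ (1≤j , j≤λ₁₊ᵢ))

lowerEnvelope-rightE⇒part≤ : ∀ λs i → LowerEnvelope λs (rightE i j) → part λs i ≤ j
lowerEnvelope-rightE⇒part≤ _ _ (_ , right∉λ) = ≮⇒≥ (λ j<λᵢ → right∉λ (s≤s z≤n , j<λᵢ))

lowerEnvelope-row≤⇒col≤ : Linked _≥_ λs → LowerEnvelope λs (lowerE i j) →
  LowerEnvelope λs (rightE i' j') → i' ≤ i → j ≤ j'
lowerEnvelope-row≤⇒col≤ {λs} {i' = zero} _ _ (mem , _) _ = contradiction mem (row0∉λ λs)
lowerEnvelope-row≤⇒col≤ {λs} {suc i} {j} {suc i'} {j'} l env env' (s≤s i'≤i) = begin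
  j                ≤⟨ proj₂ (proj₁ env) ⟩
  part λs (suc i)  ≤⟨ part-antitone l i'≤i ⟩
  part λs (suc i') ≤⟨ lowerEnvelope-rightE⇒part≤ λs (suc i') env' ⟩
  j'               ∎
  where open ≤-Reasoning

lowerEnvelope-row>⇒col> : Linked _≥_ λs → LowerEnvelope λs (lowerE i j) →
  LowerEnvelope λs (rightE i' j') → i < i' → j' < j
lowerEnvelope-row>⇒col> {λs} {i} {j} {suc i'} {j'} l env env' (s≤s i≤i') = begin-strict
  j'               ≤⟨ proj₂ (proj₁ env') ⟩
  part λs (suc i') ≤⟨ part-antitone l i≤i' ⟩
  part λs (suc i)  <⟨ lowerEnvelope-lowerE⇒part< λs i env ⟩
  j                ∎
  where open ≤-Reasoning

lowerE-Precedes-rightE : j ≤ j' → i' ≤ i → lowerE i j Precedes rightE i' j'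
lowerE-Precedes-rightE j≤j' i'≤i = double-mono j≤j' , double-mono i'≤i , λ ()
  where
  double-mono : ∀ {m n} → m ≤ n → 2 * m ≤ 2 * n + 1
  double-mono {n = n} m≤n = ≤-trans (*-monoʳ-≤ 2 m≤n) (m≤m+n (2 * n) 1)

corollary2p2 : (λs : List ℕ) → IsPartition λs →
    (e e' : Edge) → LowerEnvelope λs e → LowerEnvelope λs e' →
    letter λs e ≡ L → letter λs e' ≡ R → e Precedes e'
corollary2p2 λs _ (rightE i j) _ _ _ eL _ = contradiction eL (letter-rightE≢L λs i j)
corollary2p2 λs _ (lowerE _ _) (lowerE i' j') _ _ _ eR = contradiction eR (letter-lowerE≢R λs i' j')
corollary2p2 λs (l , _) (lowerE i j) (rightE i' j') env env' eL eR with i' ≤? i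
... | yes i'≤i = lowerE-Precedes-rightE (lowerEnvelope-row≤⇒col≤ l env env' i'≤i) i'≤i
... | no i'≰i  = contradiction i<i (<-irrefl refl)
  where
  open ≤-Reasoning
  i<i' : i < i'
  i<i' = ≰⇒> i'≰i
  i<i : i < i
  i<i = begin-strict
    i  <⟨ i<i' ⟩
    i' ≤⟨ isEven-snakeLength-rightE⇒row≤col l (proj₁ env') (letter-rightE≡R⇒isEven λs i' j' eR) ⟩
    j' <⟨ lowerEnvelope-row>⇒col> l env env' i<i' ⟩
    j  ≤⟨ isEven-snakeLength-lowerE⇒col≤row l (proj₁ env) (letter-lowerE≡L⇒isEven λs i j eL) ⟩
    i  ∎
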